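{- Let $b\ge2$ and let $V_b^0$ be the set of real-valued $b$-periodic functions $f$ on $\mathbb{Z}$ with $\sum_{j=0}^{b-1}f(j)=0$, equipped with convolution $*$. Then $S_b$ is the identity element of $(V_b^0,*)$, and every Fourier–Dedekind sum $S_{(a_1,\dots,a_d;b)}$ (with all $a_i$ coprime to $b$) has a unique inverse under $*$ in $V_b^0$. When $d\ge1$, this inverse is the function \[t\mapsto (I-T^{a_1})(I-T^{a_2})\cdots(I-T^{a_d})\,\delta_{\mathbb{Z}}\!\left(\tfrac{t}{b}\right).\]
   Context: $\xi_b=e^{2\pi i/b}$. For positive integers $a_1,\dots,a_d$ coprime to $b$, $S_{(a_1,\dots,a_d;b)}(n)=\frac1b\sum_{j=1}^{b-1}\frac{\xi_b^{jn}}{(1-\xi_b^{ja_1})\cdots(1-\xi_b^{ja_d})}$; for $d=0$ this is $S_b(n)=\frac1b\sum_{j=1}^{b-1}\xi_b^{jn}$. The convolution of $b$-periodic $f,g$ is $(f*g)(t)=\sum_{m=0}^{b-1}f(t-m)g(m)$. $\delta_{\mathbb{Z}}(x)=1$ if $x\in\mathbb{Z}$ and $0$ otherwise; $I$ is the identity operator and $(T^ah)(t)=h(t+a)$. -}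

module Defs where

open import Level using (Level; _⊔_)
open import Data.Nat as ℕ using (ℕ; zero; suc)
open import Data.Nat.Coprimality using (Coprime)
open import Data.Integer as ℤ using (ℤ; +_; -[1+_])
import Data.Nat.Divisibility as ℕDiv
open import Data.List using (List; []; _∷_; foldr)
open import Data.Product using (_×_; Σ; ∃)
open import Relation.Nullary using (¬_; yes; no)
open import Algebra.Bundles using (CommutativeRing)

record Field (c ℓ : Level) : Set (Level.suc (c ⊔ ℓ)) where
  field
    commRing : CommutativeRing c ℓ
  open CommutativeRing commRing public
  field
    _⁻¹      : Carrier → Carrier
    1≉0      : ¬ (1# ≈ 0#)
    ⁻¹-inverse : ∀ x → ¬ (x ≈ 0#) → x * (x ⁻¹) ≈ 1#

module Fourier {c ℓ : Level} (F : Field c ℓ) (b : ℕ) (ξ : Field.Carrier F) where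
  open Field F

  _^ℕ_ : Carrier → ℕ → Carrier
  x ^ℕ zero  = 1#
  x ^ℕ suc k = x * (x ^ℕ k)

  _^ℤ_ : Carrier → ℤ → Carrier
  x ^ℤ (+ k)     = x ^ℕ k
  x ^ℤ -[1+ k ]  = (x ⁻¹) ^ℕ suc k

  fromℕ : ℕ → Carrier
  fromℕ zero    = 0#
  fromℕ (suc k) = 1# + fromℕ k

  sumFrom : ℕ → ℕ → (ℕ → Carrier) → Carrier
  sumFrom lo zero      f = 0#
  sumFrom lo (suc len) f = f lo + sumFrom (suc lo) len f

  IsPrimitiveRoot : Set ℓ
  IsPrimitiveRoot = (ξ ^ℕ b ≈ 1#) × (∀ k → 0 ℕ.< k → k ℕ.< b → ¬ (ξ ^ℕ k ≈ 1#))

  Fun : Set c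
  Fun = ℤ → Carrier

  Periodic : Fun → Set ℓ
  Periodic f = ∀ t → f (t ℤ.+ + b) ≈ f t

  InV0 : Fun → Set ℓ
  InV0 f = Periodic f × (sumFrom 0 b (λ j → f (+ j)) ≈ 0#)

  conv : Fun → Fun → Fun
  conv f g t = sumFrom 0 b (λ m → f (t ℤ.- + m) * g (+ m))

  _≗F_ : Fun → Fun → Set ℓ
  f ≗F g = ∀ t → f t ≈ g t

  prodDen : List ℕ → ℕ → Carrier
  prodDen as j = foldr (λ a r → (1# - ξ ^ℕ (j ℕ.* a)) * r) 1# as

  S : List ℕ → Fun
  S as n = (fromℕ b) ⁻¹ * sumFrom 1 (b ℕ.∸ 1)
             (λ j → (ξ ^ℤ (+ j ℤ.* n)) * (prodDen as j) ⁻¹)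

  Sb : Fun
  Sb = S []

  δb : Fun
  δb t with b ℕDiv.∣? ℤ.∣ t ∣
  ... | yes _ = 1#
  ... | no  _ = 0#

  IminusT : ℕ → Fun → Fun
  IminusT a h t = h t - h (t ℤ.+ + a)

  invFormula : List ℕ → Fun
  invFormula as = foldr IminusT δb as

module Submission where

open import Defs
open import Level using (Level)
open import Data.Nat using (ℕ; _≤_)
open import Data.Nat.Coprimality using (Coprime)
open import Data.List using (List; [])
open import Data.List.Relation.Unary.All using (All)
open import Data.Product using (_×_; Σ)
open import Relation.Nullary using (¬_)
open import Relation.Binary.PropositionalEquality using (_≡_)

open import Data.Nat as ℕ using (zero; suc; _<_; z≤n; s≤s)
import Data.Nat.Properties as ℕP
open import Data.Nat.Divisibility using (_∣_; _∣?_; divides; n∣m*n; m∣m*n; _∣0; >⇒∤; m%n≡0⇒n∣m)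
open import Data.Nat.DivMod using (_%_; _/_; m≡m%n+[m/n]*n; m%n<n)
open import Data.Nat.Coprimality using (coprime-divisor)
import Data.Nat.Coprimality as Coprime
open import Data.Integer as ℤ using (ℤ; +_; -[1+_])
import Data.Integer.Properties as ℤP
import Data.Integer.DivMod as ℤD
open import Data.Integer.Tactic.RingSolver using (solve-∀)
open import Data.Fin using (Fin; toℕ)
open import Data.Fin.Properties using (suc-injective; toℕ-injective; toℕ<n)
open import Data.Vec using (Vec; []; _∷_; replicate)
open import Data.List using (_∷_)
open import Data.List.Relation.Unary.All using ([]; _∷_)
open import Data.Product using (_,_; proj₁; proj₂)
open import Function using (_∘_)
open import Relation.Nullary using (yes; no; contradiction)
open import Relation.Binary.PropositionalEquality as Eq using (_≢_)

-- The proof diagonalises convolution.  Every b-periodic G is recovered from its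
-- coefficients dft G k = Σ_{m<b} G(m) ξ^{-mk} as G = idft (dft G), where
-- idft u t = b⁻¹ Σ_{j<b} u_j ξ^{jt}, and conv (idft u) (idft v) = idft (u·v); both
-- follow from the orthogonality Σ_{m<b} ξ^{m(j-k)} = b·[j = k].  Membership in V_b^0
-- means that the 0-th coefficient vanishes.  S_{(a;b)} has coefficients
-- 1/Π_i (1 - ξ^{j a_i}) for 0 < j < b (nonzero because the a_i are coprime to b) and
-- 0 at j = 0, so on V_b^0 the unit is S_b (coefficients 1 off 0), the inverse of
-- S_{(a;b)} has coefficients Π_i (1 - ξ^{j a_i}), and uniqueness is comparison of
-- coefficients.  The operator formula has the same coefficients: δ_ℤ(t/b) has all
-- coefficients 1 and I - T^a multiplies the j-th one by 1 - ξ^{ja}.  Dividing by b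
-- needs b ≠ 0 in the field: 1 + z + ⋯ + z^{b-1} vanishes at the b - 1 distinct points
-- ξ, …, ξ^{b-1}, so it cannot also vanish at 1, where its value is b.

module FieldProperties {c ℓ : Level} (F : Field c ℓ) where
  open Field F
  open import Relation.Binary.Reasoning.Setoid setoid
  open import Algebra.Properties.Group +-group using (x≈y⇒x∙y⁻¹≈ε; x∙y⁻¹≈ε⇒x≈y)
  open import Algebra.Properties.Ring ring using ([y-z]x≈yx-zx; x[y-z]≈xy-xz)
  open import Algebra.Properties.CommutativeSemigroup *-commutativeSemigroup using (x∙yz≈y∙xz)

  x*y≈0⇒y≈0 : ∀ {x y} → ¬ x ≈ 0# → x * y ≈ 0# → y ≈ 0#
  x*y≈0⇒y≈0 {x} {y} x≉0 xy≈0 = begin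
    y                ≈⟨ *-identityˡ y ⟨
    1# * y           ≈⟨ *-congʳ (⁻¹-inverse x x≉0) ⟨
    (x * x ⁻¹) * y   ≈⟨ *-assoc x (x ⁻¹) y ⟩
    x * (x ⁻¹ * y)   ≈⟨ x∙yz≈y∙xz x (x ⁻¹) y ⟩
    x ⁻¹ * (x * y)   ≈⟨ *-congˡ xy≈0 ⟩
    x ⁻¹ * 0#        ≈⟨ zeroʳ _ ⟩
    0#               ∎

  x*y≉0 : ∀ {x y} → ¬ x ≈ 0# → ¬ y ≈ 0# → ¬ x * y ≈ 0#
  x*y≉0 x≉0 y≉0 xy≈0 = y≉0 (x*y≈0⇒y≈0 x≉0 xy≈0)

  x*z≈y*z⇒z≈0 : ∀ {x y z} → ¬ x ≈ y → x * z ≈ y * z → z ≈ 0#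
  x*z≈y*z⇒z≈0 {x} {y} {z} x≉y xz≈yz = x*y≈0⇒y≈0 x-y≉0 (begin
    (x - y) * z      ≈⟨ [y-z]x≈yx-zx z x y ⟩
    x * z - y * z    ≈⟨ x≈y⇒x∙y⁻¹≈ε xz≈yz ⟩
    0#               ∎)
    where
    x-y≉0 : ¬ x - y ≈ 0#
    x-y≉0 x-y≈0 = x≉y (x∙y⁻¹≈ε⇒x≈y x y x-y≈0)

  *-cancelʳ : ∀ {x y z} → ¬ z ≈ 0# → x * z ≈ y * z → x ≈ y
  *-cancelʳ {x} {y} {z} z≉0 xz≈yz = x∙y⁻¹≈ε⇒x≈y x y (x*y≈0⇒y≈0 z≉0 (begin
    z * (x - y)      ≈⟨ x[y-z]≈xy-xz z x y ⟩
    z * x - z * y    ≈⟨ x≈y⇒x∙y⁻¹≈ε (trans (*-comm z x) (trans xz≈yz (*-comm y z))) ⟩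
    0#               ∎))

  1⁻¹≈1 : 1# ⁻¹ ≈ 1#
  1⁻¹≈1 = trans (sym (*-identityˡ _)) (⁻¹-inverse 1# 1≉0)

  x⁻¹*y≈1⇒y≈x : ∀ {x y} → ¬ x ≈ 0# → x ⁻¹ * y ≈ 1# → y ≈ x
  x⁻¹*y≈1⇒y≈x {x} {y} x≉0 x⁻¹y≈1 = begin
    y                ≈⟨ *-identityˡ y ⟨
    1# * y           ≈⟨ *-congʳ (⁻¹-inverse x x≉0) ⟨
    (x * x ⁻¹) * y   ≈⟨ *-assoc x (x ⁻¹) y ⟩
    x * (x ⁻¹ * y)   ≈⟨ *-congˡ x⁻¹y≈1 ⟩
    x * 1#           ≈⟨ *-identityʳ x ⟩
    x                ∎

  x*y≈1∧x≈1⇒y≈1 : ∀ {x y} → x * y ≈ 1# → x ≈ 1# → y ≈ 1#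
  x*y≈1∧x≈1⇒y≈1 {x} {y} xy≈1 x≈1 = trans (sym (*-identityˡ y)) (trans (*-congʳ (sym x≈1)) xy≈1)


module MonicPolynomials {c ℓ : Level} (F : Field c ℓ) where
  open Field F
  open FieldProperties F
  open import Relation.Binary.Reasoning.Setoid setoid
  open import Algebra.Solver.Ring.NaturalCoefficients.Default commutativeSemiring

  -- monic (v₀ ∷ ⋯ ∷ vₙ₋₁) z = zⁿ + vₙ₋₁ zⁿ⁻¹ + ⋯ + v₀, in Horner form.
  monic : ∀ {n} → Vec Carrier n → Carrier → Carrier
  monic []      z = 1#
  monic (a ∷ v) z = a + z * monic v z

  divideBy : ∀ {n} → Carrier → Vec Carrier (suc n) → Vec Carrier n
  divideBy r (a ∷ [])     = []
  divideBy r (a ∷ a′ ∷ v) = monic (a′ ∷ v) r ∷ divideBy r (a′ ∷ v)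

  -- Division by z - r with remainder monic v r, with the terms moved so that no
  -- subtraction occurs (it is then a semiring identity).
  monic-divideBy : ∀ {n} r (v : Vec Carrier (suc n)) z →
    monic v z + r * monic (divideBy r v) z ≈ z * monic (divideBy r v) z + monic v r
  monic-divideBy r (a ∷ []) z =
    solve 3 (λ a z r → (a :+ z :* con 1) :+ r :* con 1 := z :* con 1 :+ (a :+ r :* con 1)) refl a z r
  monic-divideBy r (a ∷ a′ ∷ v) z = begin
    (a + z * W) + r * (E + z * Q)
      ≈⟨ solve 6 (λ a z r W E Q → (a :+ z :* W) :+ r :* (E :+ z :* Q)
                                  := (a :+ r :* E) :+ z :* (W :+ r :* Q)) refl a z r W E Q ⟩
    (a + r * E) + z * (W + r * Q)
      ≈⟨ +-congˡ (*-congˡ (monic-divideBy r (a′ ∷ v) z)) ⟩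
    (a + r * E) + z * (z * Q + E)
      ≈⟨ solve 5 (λ a z r E Q → (a :+ r :* E) :+ z :* (z :* Q :+ E)
                                := z :* (E :+ z :* Q) :+ (a :+ r :* E)) refl a z r E Q ⟩
    z * (E + z * Q) + (a + r * E)   ∎
    where
    W = monic (a′ ∷ v) z
    E = monic (a′ ∷ v) r
    Q = monic (divideBy r (a′ ∷ v)) z

  monic-root-divides : ∀ {n} {r} (v : Vec Carrier (suc n)) → monic v r ≈ 0# →
    ∀ {z} → ¬ z ≈ r → monic v z ≈ 0# → monic (divideBy r v) z ≈ 0#
  monic-root-divides {r = r} v vr≈0 {z} z≉r vz≈0 = x*z≈y*z⇒z≈0 z≉r (begin
    z * Q              ≈⟨ +-identityʳ _ ⟨
    z * Q + 0#         ≈⟨ +-congˡ vr≈0 ⟨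
    z * Q + monic v r  ≈⟨ monic-divideBy r v z ⟨
    monic v z + r * Q  ≈⟨ +-congʳ vz≈0 ⟩
    0# + r * Q         ≈⟨ +-identityˡ _ ⟩
    r * Q              ∎)
    where Q = monic (divideBy r v) z

  monic-nonvanishing : ∀ {n} (v : Vec Carrier n) (ρ : Fin n → Carrier) →
    (∀ i j → i ≢ j → ¬ ρ i ≈ ρ j) → (∀ i → monic v (ρ i) ≈ 0#) →
    ∀ {s} → (∀ i → ¬ s ≈ ρ i) → ¬ monic v s ≈ 0#
  monic-nonvanishing []        _ _        _     _   = 1≉0
  monic-nonvanishing v@(_ ∷ _) ρ distinct roots s≉ρ vs≈0 =
    monic-nonvanishing (divideBy (ρ Fin.zero) v) (λ i → ρ (Fin.suc i))
      (λ i j i≢j → distinct (Fin.suc i) (Fin.suc j) (λ eq → i≢j (suc-injective eq)))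
      (λ i → monic-root-divides v (roots Fin.zero) (distinct (Fin.suc i) Fin.zero λ ()) (roots (Fin.suc i)))
      (λ i → s≉ρ (Fin.suc i))
      (monic-root-divides v (roots Fin.zero) (s≉ρ Fin.zero) vs≈0)

module DiscreteFourier {c ℓ : Level} (F : Field c ℓ) (b : ℕ) (ξ : Field.Carrier F) where
  open Field F
  open Fourier F b ξ
  open FieldProperties F
  open MonicPolynomials F
  open import Relation.Binary.Reasoning.Setoid setoid
  open import Algebra.Properties.AbelianGroup +-abelianGroup using (⁻¹-∙-comm)
  open import Algebra.Properties.Group +-group
    using (ε⁻¹≈ε; x∙y⁻¹≈ε⇒x≈y) renaming (∙-cancelˡ to +-cancelˡ)
  open import Algebra.Properties.Ring ring using (x[y-z]≈xy-xz; [y-z]x≈yx-zx)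
  open import Algebra.Properties.CommutativeSemigroup +-commutativeSemigroup using (interchange)
  open import Algebra.Properties.CommutativeSemigroup *-commutativeSemigroup using (x∙yz≈y∙xz; x∙yz≈z∙xy)
  open import Algebra.Properties.Semiring.Exp semiring using (_^_; ^-homo-*; ^-assocʳ)
  open import Algebra.Properties.CommutativeSemiring.Exp commutativeSemiring using (^-distrib-*)
  open import Algebra.Solver.Ring.NaturalCoefficients.Default commutativeSemiring

  -- Finite sums

  private
    <-step : ∀ {lo n i} → i < suc lo ℕ.+ n → i < lo ℕ.+ suc n
    <-step {lo} {n} {i} = Eq.subst (i <_) (Eq.sym (ℕP.+-suc lo n))

  sum-cong : ∀ lo n {f g} → (∀ i → f i ≈ g i) → sumFrom lo n f ≈ sumFrom lo n g
  sum-cong lo zero    f≈g = refl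
  sum-cong lo (suc n) f≈g = +-cong (f≈g lo) (sum-cong (suc lo) n f≈g)

  sum-cong-< : ∀ lo n {f g} → (∀ i → lo ≤ i → i < lo ℕ.+ n → f i ≈ g i) →
    sumFrom lo n f ≈ sumFrom lo n g
  sum-cong-< lo zero    f≈g = refl
  sum-cong-< lo (suc n) f≈g = +-cong (f≈g lo ℕP.≤-refl (ℕP.m<m+n lo (s≤s z≤n)))
    (sum-cong-< (suc lo) n λ i lo<i i< → f≈g i (ℕP.<⇒≤ lo<i) (<-step i<))

  sum-zero : ∀ lo n {f} → (∀ i → lo ≤ i → i < lo ℕ.+ n → f i ≈ 0#) → sumFrom lo n f ≈ 0#
  sum-zero lo zero    f≈0 = refl
  sum-zero lo (suc n) f≈0 = trans (+-cong (f≈0 lo ℕP.≤-refl (ℕP.m<m+n lo (s≤s z≤n)))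
    (sum-zero (suc lo) n λ i lo<i i< → f≈0 i (ℕP.<⇒≤ lo<i) (<-step i<))) (+-identityˡ 0#)

  sum-single : ∀ lo n {f k} → lo ≤ k → k < lo ℕ.+ n →
    (∀ i → lo ≤ i → i < lo ℕ.+ n → i ≢ k → f i ≈ 0#) → sumFrom lo n f ≈ f k
  sum-single lo zero {k = k} lo≤k k<lo+0 _ =
    contradiction (Eq.subst (k <_) (ℕP.+-identityʳ lo) k<lo+0) (ℕP.≤⇒≯ lo≤k)
  sum-single lo (suc n) {f} {k} lo≤k k< others with lo ℕ.≟ k
  ... | yes Eq.refl = trans (+-congˡ (sum-zero (suc lo) n λ i lo<i i< →
          others i (ℕP.<⇒≤ lo<i) (<-step i<) (ℕP.>⇒≢ lo<i))) (+-identityʳ _)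
  ... | no lo≢k = trans (+-congʳ (others lo ℕP.≤-refl (ℕP.m<m+n lo (s≤s z≤n)) lo≢k))
          (trans (+-identityˡ _) (sum-single (suc lo) n (ℕP.≤∧≢⇒< lo≤k lo≢k)
            (Eq.subst (k <_) (ℕP.+-suc lo n) k<) λ i lo<i i< → others i (ℕP.<⇒≤ lo<i) (<-step i<)))

  sum-split : ∀ n .{{_ : ℕ.NonZero n}} f → sumFrom 0 n f ≡ f 0 + sumFrom 1 (n ℕ.∸ 1) f
  sum-split (suc n) f = Eq.refl

  sum-shift : ∀ lo n f → sumFrom (suc lo) n f ≡ sumFrom lo n (f ∘ suc)
  sum-shift lo zero    f = Eq.refl
  sum-shift lo (suc n) f = Eq.cong (_+_ (f (suc lo))) (sum-shift (suc lo) n f)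

  sum-+ : ∀ lo n f g → sumFrom lo n (λ i → f i + g i) ≈ sumFrom lo n f + sumFrom lo n g
  sum-+ lo zero    f g = sym (+-identityʳ 0#)
  sum-+ lo (suc n) f g = trans (+-congˡ (sum-+ (suc lo) n f g)) (interchange _ _ _ _)

  sum-neg : ∀ lo n f → - sumFrom lo n f ≈ sumFrom lo n (λ i → - f i)
  sum-neg lo zero    f = ε⁻¹≈ε
  sum-neg lo (suc n) f = trans (sym (⁻¹-∙-comm _ _)) (+-congˡ (sum-neg (suc lo) n f))

  sum-- : ∀ lo n f g → sumFrom lo n f - sumFrom lo n g ≈ sumFrom lo n (λ i → f i - g i)
  sum-- lo n f g = trans (+-congˡ (sum-neg lo n g)) (sym (sum-+ lo n f (λ i → - g i)))

  *-distribˡ-sum : ∀ x lo n f → x * sumFrom lo n f ≈ sumFrom lo n (λ i → x * f i)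
  *-distribˡ-sum x lo zero    f = zeroʳ x
  *-distribˡ-sum x lo (suc n) f = trans (distribˡ x _ _) (+-congˡ (*-distribˡ-sum x (suc lo) n f))

  *-distribʳ-sum : ∀ x lo n f → sumFrom lo n f * x ≈ sumFrom lo n (λ i → f i * x)
  *-distribʳ-sum x lo n f =
    trans (*-comm _ x) (trans (*-distribˡ-sum x lo n f) (sum-cong lo n λ i → *-comm x (f i)))

  sum-swap : ∀ lo n lo′ m (h : ℕ → ℕ → Carrier) →
    sumFrom lo n (λ i → sumFrom lo′ m (h i)) ≈ sumFrom lo′ m (λ j → sumFrom lo n (λ i → h i j))
  sum-swap lo zero    lo′ m h = sym (sum-zero lo′ m λ _ _ _ → refl)
  sum-swap lo (suc n) lo′ m h = trans (+-congˡ (sum-swap (suc lo) n lo′ m h)) (sym (sum-+ lo′ m _ _))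

  sum-ones : ∀ lo n → sumFrom lo n (λ _ → 1#) ≈ fromℕ n
  sum-ones lo zero    = refl
  sum-ones lo (suc n) = +-congˡ (sum-ones (suc lo) n)

  -- Powers

  ^ℕ≡^ : ∀ x n → x ^ℕ n ≡ x ^ n
  ^ℕ≡^ x zero    = Eq.refl
  ^ℕ≡^ x (suc n) = Eq.cong (x *_) (^ℕ≡^ x n)

  ^ℕ-+ : ∀ x m n → x ^ℕ (m ℕ.+ n) ≈ x ^ℕ m * x ^ℕ n
  ^ℕ-+ x m n rewrite ^ℕ≡^ x (m ℕ.+ n) | ^ℕ≡^ x m | ^ℕ≡^ x n = ^-homo-* x m n

  ^ℕ-* : ∀ x m n → x ^ℕ (m ℕ.* n) ≈ (x ^ℕ m) ^ℕ n
  ^ℕ-* x m n rewrite ^ℕ≡^ (x ^ℕ m) n | ^ℕ≡^ x m | ^ℕ≡^ x (m ℕ.* n) = sym (^-assocʳ x m n)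

  ^ℕ-distrib-* : ∀ x y n → (x * y) ^ℕ n ≈ x ^ℕ n * y ^ℕ n
  ^ℕ-distrib-* x y n rewrite ^ℕ≡^ (x * y) n | ^ℕ≡^ x n | ^ℕ≡^ y n = ^-distrib-* x y n

  ^ℕ-congˡ : ∀ {x y} n → x ≈ y → x ^ℕ n ≈ y ^ℕ n
  ^ℕ-congˡ zero    x≈y = refl
  ^ℕ-congˡ (suc n) x≈y = *-cong x≈y (^ℕ-congˡ n x≈y)

  1^n≈1 : ∀ n → 1# ^ℕ n ≈ 1#
  1^n≈1 zero    = refl
  1^n≈1 (suc n) = trans (*-identityˡ _) (1^n≈1 n)

  x^n≈1 : ∀ {x} n → x ≈ 1# → x ^ℕ n ≈ 1#
  x^n≈1 n x≈1 = trans (^ℕ-congˡ n x≈1) (1^n≈1 n)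

  x^n≉0 : ∀ {x} n → ¬ x ≈ 0# → ¬ x ^ℕ n ≈ 0#
  x^n≉0 zero    x≉0 = 1≉0
  x^n≉0 (suc n) x≉0 = x*y≉0 x≉0 (x^n≉0 n x≉0)

  powerSum : Carrier → ℕ → Carrier
  powerSum z n = sumFrom 0 n (z ^ℕ_)

  powerSum-suc : ∀ z n → powerSum z (suc n) ≈ 1# + z * powerSum z n
  powerSum-suc z n = +-congˡ (begin
    sumFrom 1 n (z ^ℕ_)                 ≡⟨ sum-shift 0 n (z ^ℕ_) ⟩
    sumFrom 0 n (λ i → z * z ^ℕ i)      ≈⟨ *-distribˡ-sum z 0 n (z ^ℕ_) ⟨
    z * powerSum z n                    ∎)

  powerSum-telescope : ∀ z n → 1# + z * powerSum z n ≈ powerSum z n + z ^ℕ n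
  powerSum-telescope z zero    = solve 1 (λ z → con 1 :+ z :* con 0 := con 0 :+ con 1) refl z
  powerSum-telescope z (suc n) = begin
    1# + z * P′                    ≈⟨ +-congˡ (*-congˡ (powerSum-suc z n)) ⟩
    1# + z * (1# + z * P)          ≈⟨ +-congˡ (*-congˡ (powerSum-telescope z n)) ⟩
    1# + z * (P + z ^ℕ n)
      ≈⟨ solve 3 (λ z P Z → con 1 :+ z :* (P :+ Z) := (con 1 :+ z :* P) :+ z :* Z) refl z P (z ^ℕ n) ⟩
    (1# + z * P) + z * z ^ℕ n      ≈⟨ +-congʳ (powerSum-suc z n) ⟨
    P′ + z ^ℕ suc n                ∎
    where
    P = powerSum z n
    P′ = powerSum z (suc n)

  powerSum-root : ∀ {z} n → z ^ℕ n ≈ 1# → ¬ z ≈ 1# → powerSum z n ≈ 0#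
  powerSum-root {z} n zⁿ≈1 z≉1 = x*z≈y*z⇒z≈0 z≉1 (begin
    z * P          ≈⟨ +-cancelˡ 1# _ _ (begin
      1# + z * P       ≈⟨ powerSum-telescope z n ⟩
      P + z ^ℕ n       ≈⟨ +-cong (sym (*-identityˡ P)) zⁿ≈1 ⟩
      1# * P + 1#      ≈⟨ +-comm _ _ ⟩
      1# + 1# * P      ∎) ⟩
    1# * P         ∎)
    where
    P = powerSum z n

  monic-ones : ∀ z n → monic (replicate n 1#) z ≈ powerSum z (suc n)
  monic-ones z zero    = sym (+-identityʳ 1#)
  monic-ones z (suc n) = trans (+-congˡ (*-congˡ (monic-ones z n))) (sym (powerSum-suc z (suc n)))

  module IntegerPowers {x : Carrier} (x≉0 : ¬ x ≈ 0#) where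

    xx⁻¹≈1 : x * x ⁻¹ ≈ 1#
    xx⁻¹≈1 = ⁻¹-inverse x x≉0

    ^ℤ-suc : ∀ r → x ^ℤ (r ℤ.+ + 1) ≈ x ^ℤ r * x
    ^ℤ-suc (+ k)            = trans (^ℕ-+ x k 1) (*-congˡ (*-identityʳ x))
    ^ℤ-suc -[1+ zero ]      = sym (trans (*-comm _ x) (trans (*-congˡ (*-identityʳ _)) xx⁻¹≈1))
    ^ℤ-suc -[1+ suc k ]     = sym (begin
      (x ⁻¹ * y) * x        ≈⟨ *-congʳ (*-comm _ y) ⟩
      (y * x ⁻¹) * x        ≈⟨ *-assoc y _ x ⟩
      y * (x ⁻¹ * x)        ≈⟨ *-congˡ (trans (*-comm _ x) xx⁻¹≈1) ⟩
      y * 1#                ≈⟨ *-identityʳ y ⟩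
      y                     ∎)
      where y = (x ⁻¹) ^ℕ suc k

    ^ℤ-+ℕ : ∀ r n → x ^ℤ (r ℤ.+ + n) ≈ x ^ℤ r * x ^ℕ n
    ^ℤ-+ℕ r zero    = trans (reflexive (Eq.cong (x ^ℤ_) (ℤP.+-identityʳ r))) (sym (*-identityʳ _))
    ^ℤ-+ℕ r (suc n) = begin
      x ^ℤ (r ℤ.+ + suc n)           ≡⟨ Eq.cong (x ^ℤ_) (ℤP.+-assoc r (+ 1) (+ n)) ⟨
      x ^ℤ ((r ℤ.+ + 1) ℤ.+ + n)     ≈⟨ ^ℤ-+ℕ (r ℤ.+ + 1) n ⟩
      x ^ℤ (r ℤ.+ + 1) * x ^ℕ n      ≈⟨ *-congʳ (^ℤ-suc r) ⟩
      (x ^ℤ r * x) * x ^ℕ n          ≈⟨ *-assoc _ x _ ⟩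
      x ^ℤ r * x ^ℕ suc n            ∎

    ^ℤ-+ : ∀ r s → x ^ℤ (r ℤ.+ s) ≈ x ^ℤ r * x ^ℤ s
    ^ℤ-+ r (+ n)      = ^ℤ-+ℕ r n
    ^ℤ-+ r -[1+ n ]   = *-cancelʳ (x^n≉0 (suc n) x≉0) (begin
      x ^ℤ (r ℤ.+ -[1+ n ]) * x ^ℕ suc n        ≈⟨ ^ℤ-+ℕ (r ℤ.+ -[1+ n ]) (suc n) ⟨
      x ^ℤ ((r ℤ.+ -[1+ n ]) ℤ.+ + suc n)       ≡⟨ Eq.cong (x ^ℤ_) (ℤP.+-assoc r -[1+ n ] (+ suc n)) ⟩
      x ^ℤ (r ℤ.+ (-[1+ n ] ℤ.+ + suc n))       ≡⟨ Eq.cong (λ s → x ^ℤ (r ℤ.+ s)) (ℤP.+-inverseˡ (+ suc n)) ⟩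
      x ^ℤ (r ℤ.+ + 0)                          ≈⟨ ^ℤ-+ℕ r 0 ⟩
      x ^ℤ r * 1#                               ≈⟨ *-congˡ x⁻ⁿxⁿ≈1 ⟨
      x ^ℤ r * ((x ⁻¹) ^ℕ suc n * x ^ℕ suc n)     ≈⟨ *-assoc _ _ _ ⟨
      x ^ℤ r * x ^ℤ -[1+ n ] * x ^ℕ suc n       ∎)
      where
      x⁻ⁿxⁿ≈1 : (x ⁻¹) ^ℕ suc n * x ^ℕ suc n ≈ 1#
      x⁻ⁿxⁿ≈1 = trans (sym (^ℕ-distrib-* (x ⁻¹) x (suc n)))
                      (x^n≈1 (suc n) (trans (*-comm _ x) xx⁻¹≈1))

    ^ℤ-neg : ∀ r → x ^ℤ (ℤ.- r) * x ^ℤ r ≈ 1#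
    ^ℤ-neg r = trans (sym (^ℤ-+ (ℤ.- r) r)) (reflexive (Eq.cong (x ^ℤ_) (ℤP.+-inverseˡ r)))

    ^ℤ-*ℕ : ∀ k r → x ^ℤ (+ k ℤ.* r) ≈ (x ^ℤ r) ^ℕ k
    ^ℤ-*ℕ zero    r = reflexive (Eq.cong (x ^ℤ_) (ℤP.*-zeroˡ r))
    ^ℤ-*ℕ (suc k) r = trans (reflexive (Eq.cong (x ^ℤ_) (ℤP.suc-* (+ k) r)))
                           (trans (^ℤ-+ r (+ k ℤ.* r)) (*-congˡ (^ℤ-*ℕ k r)))

  powerSum-one : ∀ {z} n → z ≈ 1# → powerSum z n ≈ fromℕ n
  powerSum-one n z≈1 = trans (sum-cong 0 n λ i → x^n≈1 i z≈1) (sum-ones 0 n)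

  module Primitive {{b≢0 : ℕ.NonZero b}} (prim : IsPrimitiveRoot) where

    -- Roots of unity

    ξ^b≈1 : ξ ^ℕ b ≈ 1#
    ξ^b≈1 = proj₁ prim

    ξ≉0 : ¬ ξ ≈ 0#
    ξ≉0 ξ≈0 = 1≉0 (trans (sym ξ^b≈1) (ξ^b≈0 (ℕ.pred b) (ℕP.suc-pred b)))
      where
      ξ^b≈0 : ∀ B → suc B ≡ b → ξ ^ℕ b ≈ 0#
      ξ^b≈0 B Eq.refl = trans (*-congʳ ξ≈0) (zeroˡ _)

    open IntegerPowers ξ≉0

    ∣⇒ξ^≈1 : ∀ {n} → b ∣ n → ξ ^ℕ n ≈ 1#
    ∣⇒ξ^≈1 (divides q Eq.refl) rewrite ℕP.*-comm q b = trans (^ℕ-* ξ b q) (x^n≈1 q ξ^b≈1)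

    ξ^≈1⇒∣ : ∀ {n} → ξ ^ℕ n ≈ 1# → b ∣ n
    ξ^≈1⇒∣ {n} ξⁿ≈1 with n % b ℕ.≟ 0
    ... | yes n%b≡0 = m%n≡0⇒n∣m n b n%b≡0
    ... | no  n%b≢0 = contradiction ξ^[n%b]≈1 (proj₂ prim (n % b) (ℕP.n≢0⇒n>0 n%b≢0) (m%n<n n b))
      where
      ξ^[n%b]≈1 : ξ ^ℕ (n % b) ≈ 1#
      ξ^[n%b]≈1 = begin
        ξ ^ℕ (n % b)                          ≈⟨ *-identityʳ _ ⟨
        ξ ^ℕ (n % b) * 1#                     ≈⟨ *-congˡ (∣⇒ξ^≈1 (n∣m*n (n / b))) ⟨
        ξ ^ℕ (n % b) * ξ ^ℕ ((n / b) ℕ.* b)   ≈⟨ ^ℕ-+ ξ (n % b) _ ⟨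
        ξ ^ℕ (n % b ℕ.+ (n / b) ℕ.* b)        ≡⟨ Eq.cong (ξ ^ℕ_) (m≡m%n+[m/n]*n n b) ⟨
        ξ ^ℕ n                                ≈⟨ ξⁿ≈1 ⟩
        1#                                    ∎

    ξ^ℤ≈1⇒∣ : ∀ r → ξ ^ℤ r ≈ 1# → b ∣ ℤ.∣ r ∣
    ξ^ℤ≈1⇒∣ (+ n)      = ξ^≈1⇒∣
    ξ^ℤ≈1⇒∣ -[1+ n ] ξʳ≈1 = ξ^≈1⇒∣ (x*y≈1∧x≈1⇒y≈1 (^ℤ-neg (+ suc n)) ξʳ≈1)

    ∣⇒ξ^ℤ≈1 : ∀ r → b ∣ ℤ.∣ r ∣ → ξ ^ℤ r ≈ 1#
    ∣⇒ξ^ℤ≈1 (+ n)      = ∣⇒ξ^≈1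
    ∣⇒ξ^ℤ≈1 -[1+ n ] b∣ = x*y≈1∧x≈1⇒y≈1 (trans (*-comm _ _) (^ℤ-neg (+ suc n))) (∣⇒ξ^≈1 b∣)

    ξ^ℤ-periodic : ∀ r q → ξ ^ℤ (r ℤ.+ q ℤ.* + b) ≈ ξ ^ℤ r
    ξ^ℤ-periodic r q =
      trans (^ℤ-+ r (q ℤ.* + b)) (trans (*-congˡ (∣⇒ξ^ℤ≈1 (q ℤ.* + b) b∣qb)) (*-identityʳ _))
      where
      b∣qb : b ∣ ℤ.∣ q ℤ.* + b ∣
      b∣qb = Eq.subst (b ∣_) (Eq.sym (ℤP.∣i*j∣≡∣i∣*∣j∣ q (+ b))) (n∣m*n ℤ.∣ q ∣)

    ∣∧<⇒≡0 : ∀ {n} → b ∣ n → n < b → n ≡ 0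
    ∣∧<⇒≡0 {zero}  _   _   = Eq.refl
    ∣∧<⇒≡0 {suc n} b∣n n<b = contradiction b∣n (>⇒∤ n<b)

    ∣j-k∣⇒j≡k : ∀ {j k} → j < b → k < b → b ∣ ℤ.∣ + j ℤ.- + k ∣ → j ≡ k
    ∣j-k∣⇒j≡k {j} {k} j<b k<b b∣ =
      ℤP.+-injective (ℤP.i-j≡0⇒i≡j (+ j) (+ k) (ℤP.∣i∣≡0⇒i≡0 (∣∧<⇒≡0 b∣ ∣j-k∣<b)))
      where
      ∣j-k∣<b : ℤ.∣ + j ℤ.- + k ∣ < b
      ∣j-k∣<b = Eq.subst (_< b) (Eq.cong ℤ.∣_∣ (Eq.sym (ℤP.[+m]-[+n]≡m⊖n j k)))
                  (ℕP.≤-<-trans (ℤP.∣m⊝n∣≤m⊔n j k) (ℕP.⊔-lub j<b k<b))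

    ξ^-injective : ∀ {j k} → j < b → k < b → ξ ^ℕ j ≈ ξ ^ℕ k → j ≡ k
    ξ^-injective {j} {k} j<b k<b ξʲ≈ξᵏ = ∣j-k∣⇒j≡k j<b k<b (ξ^ℤ≈1⇒∣ (+ j ℤ.- + k) (begin
      ξ ^ℤ (+ j ℤ.- + k)             ≈⟨ ^ℤ-+ (+ j) (ℤ.- + k) ⟩
      ξ ^ℕ j * ξ ^ℤ (ℤ.- + k)        ≈⟨ *-congʳ ξʲ≈ξᵏ ⟩
      ξ ^ℕ k * ξ ^ℤ (ℤ.- + k)        ≈⟨ *-comm _ _ ⟩
      ξ ^ℤ (ℤ.- + k) * ξ ^ℤ (+ k)    ≈⟨ ^ℤ-neg (+ k) ⟩
      1#                             ∎))

    b≉0 : ¬ fromℕ b ≈ 0#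
    b≉0 = nonvanishing (ℕ.pred b) (ℕP.suc-pred b)
      where
      nonvanishing : ∀ B → suc B ≡ b → ¬ fromℕ b ≈ 0#
      nonvanishing B Eq.refl b≈0 = monic-nonvanishing (replicate B 1#) ρ distinct roots 1≉ρ (begin
        monic (replicate B 1#) 1#   ≈⟨ monic-ones 1# B ⟩
        powerSum 1# b               ≈⟨ powerSum-one b refl ⟩
        fromℕ b                     ≈⟨ b≈0 ⟩
        0#                          ∎)
        where
        ρ : Fin B → Carrier
        ρ i = ξ ^ℕ suc (toℕ i)
        distinct : ∀ i j → i ≢ j → ¬ ρ i ≈ ρ j
        distinct i j i≢j ρi≈ρj = i≢j (toℕ-injective (ℕP.suc-injective
          (ξ^-injective (s≤s (toℕ<n i)) (s≤s (toℕ<n j)) ρi≈ρj)))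
        roots : ∀ i → monic (replicate B 1#) (ρ i) ≈ 0#
        roots i = trans (monic-ones (ρ i) B) (powerSum-root b ρiᵇ≈1
          (proj₂ prim (suc (toℕ i)) (s≤s z≤n) (s≤s (toℕ<n i))))
          where
          ρiᵇ≈1 : ρ i ^ℕ b ≈ 1#
          ρiᵇ≈1 = trans (sym (^ℕ-* ξ (suc (toℕ i)) b)) (∣⇒ξ^≈1 (n∣m*n (suc (toℕ i))))
        1≉ρ : ∀ i → ¬ 1# ≈ ρ i
        1≉ρ i 1≈ρi = contradiction (ξ^-injective (s≤s z≤n) (s≤s (toℕ<n i)) 1≈ρi) λ ()

    δb-yes : ∀ {r} → b ∣ ℤ.∣ r ∣ → δb r ≈ 1#
    δb-yes {r} b∣r with b ∣? ℤ.∣ r ∣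
    ... | yes _   = refl
    ... | no b∤r  = contradiction b∣r b∤r

    δb-no : ∀ {r} → ¬ b ∣ ℤ.∣ r ∣ → δb r ≈ 0#
    δb-no {r} b∤r with b ∣? ℤ.∣ r ∣
    ... | yes b∣r = contradiction b∣r b∤r
    ... | no _    = refl

    character-sum : ∀ r → sumFrom 0 b (λ m → ξ ^ℤ (+ m ℤ.* r)) ≈ fromℕ b * δb r
    character-sum r with b ∣? ℤ.∣ r ∣
    ... | yes b∣r = begin
      sumFrom 0 b (λ m → ξ ^ℤ (+ m ℤ.* r))  ≈⟨ sum-cong 0 b (λ m → ^ℤ-*ℕ m r) ⟩
      powerSum (ξ ^ℤ r) b                  ≈⟨ powerSum-one b (∣⇒ξ^ℤ≈1 r b∣r) ⟩
      fromℕ b                              ≈⟨ *-identityʳ _ ⟨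
      fromℕ b * 1#                         ∎
    ... | no b∤r = begin
      sumFrom 0 b (λ m → ξ ^ℤ (+ m ℤ.* r))  ≈⟨ sum-cong 0 b (λ m → ^ℤ-*ℕ m r) ⟩
      powerSum (ξ ^ℤ r) b                  ≈⟨ powerSum-root b ξʳᵇ≈1 (λ ξʳ≈1 → b∤r (ξ^ℤ≈1⇒∣ r ξʳ≈1)) ⟩
      0#                                   ≈⟨ zeroʳ _ ⟨
      fromℕ b * 0#                         ∎
      where
      ξʳᵇ≈1 : (ξ ^ℤ r) ^ℕ b ≈ 1#
      ξʳᵇ≈1 = trans (sym (^ℤ-*ℕ b r)) (∣⇒ξ^ℤ≈1 (+ b ℤ.* r)
        (Eq.subst (b ∣_) (Eq.sym (ℤP.∣i*j∣≡∣i∣*∣j∣ (+ b) r)) (m∣m*n ℤ.∣ r ∣)))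

    δb-cong : ∀ {r s} → ℤ.∣ r ∣ ≡ ℤ.∣ s ∣ → δb r ≈ δb s
    δb-cong {r} {s} ∣r∣≡∣s∣ with b ∣? ℤ.∣ r ∣
    ... | yes b∣r = sym (δb-yes (Eq.subst (b ∣_) ∣r∣≡∣s∣ b∣r))
    ... | no b∤r  = sym (δb-no (λ b∣s → b∤r (Eq.subst (b ∣_) (Eq.sym ∣r∣≡∣s∣) b∣s)))

    sift : ∀ (f : ℕ → Carrier) {k} → k < b → sumFrom 0 b (λ j → f j * δb (+ j ℤ.- + k)) ≈ f k
    sift f {k} k<b = trans (sum-single 0 b z≤n k<b λ j _ j<b j≢k →
        trans (*-congˡ (δb-no (λ b∣ → j≢k (∣j-k∣⇒j≡k j<b k<b b∣)))) (zeroʳ _))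
      (trans (*-congˡ (δb-yes b∣0)) (*-identityʳ _))
      where
      b∣0 : b ∣ ℤ.∣ + k ℤ.- + k ∣
      b∣0 = Eq.subst (b ∣_) (Eq.cong ℤ.∣_∣ (Eq.sym (ℤP.+-inverseʳ (+ k)))) (b ∣0)

    orthogonality : ∀ (f : ℕ → Carrier) {k} → k < b →
      sumFrom 0 b (λ j → f j * sumFrom 0 b (λ m → ξ ^ℤ (+ m ℤ.* (+ j ℤ.- + k)))) ≈ f k * fromℕ b
    orthogonality f {k} k<b = trans (sum-cong 0 b λ j →
        trans (*-congˡ (character-sum (+ j ℤ.- + k))) (sym (*-assoc _ _ _)))
      (sift (λ j → f j * fromℕ b) k<b)

    -- The discrete Fourier transform

    β : Carrier
    β = fromℕ b ⁻¹

    bβ≈1 : fromℕ b * β ≈ 1#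
    bβ≈1 = ⁻¹-inverse (fromℕ b) b≉0

    χ : ℕ → Fun
    χ j t = ξ ^ℤ (+ j ℤ.* t)

    idft : (ℕ → Carrier) → Fun
    idft u t = β * sumFrom 0 b (λ j → u j * χ j t)

    dft : Fun → ℕ → Carrier
    dft G k = sumFrom 0 b (λ m → G (+ m) * ξ ^ℤ (+ m ℤ.* ℤ.- + k))

    r+s≡t⇒ξʳξˢ≈ξᵗ : ∀ r s {t} → r ℤ.+ s ≡ t → ξ ^ℤ r * ξ ^ℤ s ≈ ξ ^ℤ t
    r+s≡t⇒ξʳξˢ≈ξᵗ r s r+s≡t = trans (sym (^ℤ-+ r s)) (reflexive (Eq.cong (ξ ^ℤ_) r+s≡t))

    χ-periodic : ∀ j t → χ j (t ℤ.+ + b) ≈ χ j t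
    χ-periodic j t = trans (reflexive (Eq.cong (ξ ^ℤ_) (ℤP.*-distribˡ-+ (+ j) t (+ b))))
                           (ξ^ℤ-periodic (+ j ℤ.* t) (+ j))

    β*[b*x]≈x : ∀ x → β * (fromℕ b * x) ≈ x
    β*[b*x]≈x x = begin
      β * (fromℕ b * x)     ≈⟨ *-assoc β _ x ⟨
      (β * fromℕ b) * x     ≈⟨ *-congʳ (trans (*-comm β _) bβ≈1) ⟩
      1# * x                ≈⟨ *-identityˡ x ⟩
      x                     ∎

    sum-*-idft : ∀ (A : ℕ → Carrier) v (τ : ℕ → ℤ) →
      sumFrom 0 b (λ m → A m * idft v (τ m)) ≈
      β * sumFrom 0 b (λ k → v k * sumFrom 0 b (λ m → A m * χ k (τ m)))
    sum-*-idft A v τ = begin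
      sumFrom 0 b (λ m → A m * (β * R m))
        ≈⟨ sum-cong 0 b (λ m → x∙yz≈y∙xz (A m) β (R m)) ⟩
      sumFrom 0 b (λ m → β * (A m * R m))
        ≈⟨ *-distribˡ-sum β 0 b _ ⟨
      β * sumFrom 0 b (λ m → A m * R m)
        ≈⟨ *-congˡ (sum-cong 0 b λ m → *-distribˡ-sum (A m) 0 b _) ⟩
      β * sumFrom 0 b (λ m → sumFrom 0 b (λ k → A m * (v k * χ k (τ m))))
        ≈⟨ *-congˡ (sum-swap 0 b 0 b _) ⟩
      β * sumFrom 0 b (λ k → sumFrom 0 b (λ m → A m * (v k * χ k (τ m))))
        ≈⟨ *-congˡ (sum-cong 0 b λ k → trans (sum-cong 0 b λ m → x∙yz≈y∙xz (A m) (v k) _)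
                                             (sym (*-distribˡ-sum (v k) 0 b _))) ⟩
      β * sumFrom 0 b (λ k → v k * sumFrom 0 b (λ m → A m * χ k (τ m)))  ∎
      where
      R : ℕ → Carrier
      R m = sumFrom 0 b (λ k → v k * χ k (τ m))

    conv-χ-idft : ∀ v {j} → j < b → ∀ t → conv (χ j) (idft v) t ≈ v j * χ j t
    conv-χ-idft v {j} j<b t = begin
      sumFrom 0 b (λ m → χ j (t ℤ.- + m) * idft v (+ m))
        ≈⟨ sum-*-idft (λ m → χ j (t ℤ.- + m)) v (λ m → + m) ⟩
      β * sumFrom 0 b (λ k → v k * sumFrom 0 b (λ m → χ j (t ℤ.- + m) * χ k (+ m)))
        ≈⟨ *-congˡ (sum-cong 0 b λ k → trans (*-congˡ (trans (sum-cong 0 b (product k))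
             (sym (*-distribˡ-sum (χ j t) 0 b _)))) (sym (*-assoc _ _ _))) ⟩
      β * sumFrom 0 b (λ k → (v k * χ j t) * sumFrom 0 b (λ m → ξ ^ℤ (+ m ℤ.* (+ k ℤ.- + j))))
        ≈⟨ *-congˡ (orthogonality (λ k → v k * χ j t) j<b) ⟩
      β * ((v j * χ j t) * fromℕ b)
        ≈⟨ *-congˡ (*-comm _ _) ⟩
      β * (fromℕ b * (v j * χ j t))
        ≈⟨ β*[b*x]≈x _ ⟩
      v j * χ j t  ∎
      where
      exponent : ∀ j t m k → j ℤ.* (t ℤ.- m) ℤ.+ k ℤ.* m ≡ j ℤ.* t ℤ.+ m ℤ.* (k ℤ.- j)
      exponent = solve-∀
      product : ∀ k m → χ j (t ℤ.- + m) * χ k (+ m) ≈ χ j t * ξ ^ℤ (+ m ℤ.* (+ k ℤ.- + j))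
      product k m = trans
        (r+s≡t⇒ξʳξˢ≈ξᵗ (+ j ℤ.* (t ℤ.- + m)) (+ k ℤ.* + m) (exponent (+ j) t (+ m) (+ k)))
                            (sym (r+s≡t⇒ξʳξˢ≈ξᵗ (+ j ℤ.* t) (+ m ℤ.* (+ k ℤ.- + j)) Eq.refl))

    conv-idft : ∀ u v t → conv (idft u) (idft v) t ≈ idft (λ j → u j * v j) t
    conv-idft u v t = begin
      sumFrom 0 b (λ m → idft u (t ℤ.- + m) * idft v (+ m))
        ≈⟨ sum-cong 0 b (λ m → *-comm _ _) ⟩
      sumFrom 0 b (λ m → idft v (+ m) * idft u (t ℤ.- + m))
        ≈⟨ sum-*-idft (λ m → idft v (+ m)) u (λ m → t ℤ.- + m) ⟩
      β * sumFrom 0 b (λ j → u j * sumFrom 0 b (λ m → idft v (+ m) * χ j (t ℤ.- + m)))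
        ≈⟨ *-congˡ (sum-cong-< 0 b λ j _ j<b → *-congˡ (trans (sum-cong 0 b λ m → *-comm _ _)
             (conv-χ-idft v j<b t))) ⟩
      β * sumFrom 0 b (λ j → u j * (v j * χ j t))
        ≈⟨ *-congˡ (sum-cong 0 b λ j → sym (*-assoc _ _ _)) ⟩
      idft (λ j → u j * v j) t  ∎

    dft-idft : ∀ u {k} → k < b → dft (idft u) k ≈ u k
    dft-idft u {k} k<b = begin
      sumFrom 0 b (λ m → idft u (+ m) * ξ ^ℤ (+ m ℤ.* ℤ.- + k))
        ≈⟨ sum-cong 0 b (λ m → *-comm _ _) ⟩
      sumFrom 0 b (λ m → ξ ^ℤ (+ m ℤ.* ℤ.- + k) * idft u (+ m))
        ≈⟨ sum-*-idft _ u (λ m → + m) ⟩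
      β * sumFrom 0 b (λ j → u j * sumFrom 0 b (λ m → ξ ^ℤ (+ m ℤ.* ℤ.- + k) * χ j (+ m)))
        ≈⟨ *-congˡ (sum-cong 0 b λ j → *-congˡ (sum-cong 0 b λ m →
             r+s≡t⇒ξʳξˢ≈ξᵗ (+ m ℤ.* ℤ.- + k) (+ j ℤ.* + m) (exponent (+ m) (+ j) (+ k)))) ⟩
      β * sumFrom 0 b (λ j → u j * sumFrom 0 b (λ m → ξ ^ℤ (+ m ℤ.* (+ j ℤ.- + k))))
        ≈⟨ *-congˡ (orthogonality u k<b) ⟩
      β * (u k * fromℕ b)
        ≈⟨ *-congˡ (*-comm _ _) ⟩
      β * (fromℕ b * u k)
        ≈⟨ β*[b*x]≈x _ ⟩
      u k  ∎
      where
      exponent : ∀ m j k → m ℤ.* ℤ.- k ℤ.+ j ℤ.* m ≡ m ℤ.* (j ℤ.- k)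
      exponent = solve-∀

    periodic-+ℕ : ∀ {G} → Periodic G → ∀ x n → G (x ℤ.+ + n ℤ.* + b) ≈ G x
    periodic-+ℕ {G} G-per x zero    = reflexive (Eq.cong G (exponent x (+ b)))
      where
      exponent : ∀ x b → x ℤ.+ ℤ.0ℤ ℤ.* b ≡ x
      exponent = solve-∀
    periodic-+ℕ {G} G-per x (suc n) = trans (reflexive (Eq.cong G (exponent x (+ n) (+ b))))
                                        (trans (G-per _) (periodic-+ℕ G-per x n))
      where
      exponent : ∀ x n b → x ℤ.+ (ℤ.1ℤ ℤ.+ n) ℤ.* b ≡ (x ℤ.+ n ℤ.* b) ℤ.+ b
      exponent = solve-∀

    periodic-ℤ : ∀ {G} → Periodic G → ∀ x q → G (x ℤ.+ q ℤ.* + b) ≈ G x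
    periodic-ℤ G-per x (+ n)      = periodic-+ℕ G-per x n
    periodic-ℤ {G} G-per x -[1+ n ] = trans (sym (periodic-+ℕ G-per _ (suc n)))
                                           (reflexive (Eq.cong G (exponent x (+ suc n) (+ b))))
      where
      exponent : ∀ x n b → (x ℤ.+ (ℤ.- n) ℤ.* b) ℤ.+ n ℤ.* b ≡ x
      exponent = solve-∀

    periodic-mod : ∀ {G} → Periodic G → ∀ t → G t ≈ G (+ (t ℤ.%ℕ b))
    periodic-mod {G} G-per t = trans (reflexive (Eq.cong G (ℤD.a≡a%ℕn+[a/ℕn]*n t b)))
                                     (periodic-ℤ G-per (+ (t ℤ.%ℕ b)) (t ℤ./ℕ b))

    idft-periodic : ∀ u → Periodic (idft u)
    idft-periodic u t = *-congˡ (sum-cong 0 b λ j → *-congˡ (χ-periodic j t))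

    idft-dft-residue : ∀ G {s} → s < b → idft (dft G) (+ s) ≈ G (+ s)
    idft-dft-residue G {s} s<b = begin
      β * sumFrom 0 b (λ j → dft G j * χ j (+ s))
        ≈⟨ *-congˡ (sum-cong 0 b λ j → *-distribʳ-sum (χ j (+ s)) 0 b _) ⟩
      β * sumFrom 0 b (λ j → sumFrom 0 b (λ m → (G (+ m) * ξ ^ℤ (+ m ℤ.* ℤ.- + j)) * χ j (+ s)))
        ≈⟨ *-congˡ (sum-swap 0 b 0 b _) ⟩
      β * sumFrom 0 b (λ m → sumFrom 0 b (λ j → (G (+ m) * ξ ^ℤ (+ m ℤ.* ℤ.- + j)) * χ j (+ s)))
        ≈⟨ *-congˡ (sum-cong 0 b λ m →
             trans (sum-cong 0 b (term m)) (sym (*-distribˡ-sum (G (+ m)) 0 b _))) ⟩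
      β * sumFrom 0 b (λ m → G (+ m) * sumFrom 0 b (λ j → ξ ^ℤ (+ j ℤ.* (+ s ℤ.- + m))))
        ≈⟨ *-congˡ (sum-cong 0 b λ m → *-congˡ (trans (character-sum (+ s ℤ.- + m))
             (*-congˡ (δb-cong (ℤP.∣i-j∣≡∣j-i∣ (+ s) (+ m)))))) ⟩
      β * sumFrom 0 b (λ m → G (+ m) * (fromℕ b * δb (+ m ℤ.- + s)))
        ≈⟨ *-congˡ (sum-cong 0 b λ m → x∙yz≈y∙xz _ _ _) ⟩
      β * sumFrom 0 b (λ m → fromℕ b * (G (+ m) * δb (+ m ℤ.- + s)))
        ≈⟨ *-congˡ (*-distribˡ-sum (fromℕ b) 0 b _) ⟨
      β * (fromℕ b * sumFrom 0 b (λ m → G (+ m) * δb (+ m ℤ.- + s)))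
        ≈⟨ β*[b*x]≈x _ ⟩
      sumFrom 0 b (λ m → G (+ m) * δb (+ m ℤ.- + s))
        ≈⟨ sift (λ m → G (+ m)) s<b ⟩
      G (+ s)  ∎
      where
      exponent : ∀ m j s → m ℤ.* ℤ.- j ℤ.+ j ℤ.* s ≡ j ℤ.* (s ℤ.- m)
      exponent = solve-∀
      term : ∀ m j → (G (+ m) * ξ ^ℤ (+ m ℤ.* ℤ.- + j)) * χ j (+ s) ≈
                    G (+ m) * ξ ^ℤ (+ j ℤ.* (+ s ℤ.- + m))
      term m j = trans (*-assoc _ _ _) (*-congˡ
        (r+s≡t⇒ξʳξˢ≈ξᵗ (+ m ℤ.* ℤ.- + j) (+ j ℤ.* + s) (exponent (+ m) (+ j) (+ s))))

    idft-dft : ∀ G → Periodic G → ∀ t → idft (dft G) t ≈ G t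
    idft-dft G G-per t = begin
      idft (dft G) t             ≈⟨ periodic-mod (idft-periodic (dft G)) t ⟩
      idft (dft G) (+ (t ℤ.%ℕ b)) ≈⟨ idft-dft-residue G (ℤD.n%ℕd<d t b) ⟩
      G (+ (t ℤ.%ℕ b))            ≈⟨ periodic-mod G-per t ⟨
      G t                         ∎

    dft-zero : ∀ G → dft G 0 ≈ sumFrom 0 b (λ m → G (+ m))
    dft-zero G = sum-cong 0 b λ m →
      trans (*-congˡ (reflexive (Eq.cong (ξ ^ℤ_) (ℤP.*-zeroʳ (+ m))))) (*-identityʳ _)

    sum-idft : ∀ u → sumFrom 0 b (λ t → idft u (+ t)) ≈ u 0
    sum-idft u = trans (sym (dft-zero (idft u))) (dft-idft u (ℕ.>-nonZero⁻¹ b))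

    idft∈V0 : ∀ u → u 0 ≈ 0# → InV0 (idft u)
    idft∈V0 u u0≈0 = idft-periodic u , trans (sum-idft u) u0≈0

    InV0-resp-≗F : ∀ {G H} → G ≗F H → InV0 H → InV0 G
    InV0-resp-≗F G≗H (H-per , ΣH≈0) =
      (λ t → trans (G≗H _) (trans (H-per t) (sym (G≗H t)))) , trans (sum-cong 0 b λ m → G≗H (+ m)) ΣH≈0

    idft-cong : ∀ {u v} → (∀ j → j < b → u j ≈ v j) → idft u ≗F idft v
    idft-cong u≈v t = *-congˡ (sum-cong-< 0 b λ j _ j<b → *-congʳ (u≈v j j<b))

    dft-cong : ∀ {G H} → G ≗F H → ∀ k → dft G k ≈ dft H k
    dft-cong G≗H k = sum-cong 0 b λ m → *-congʳ (G≗H (+ m))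

    idft-injective : ∀ {u v} → idft u ≗F idft v → ∀ k → k < b → u k ≈ v k
    idft-injective {u} {v} u≗v k k<b = trans (sym (dft-idft u k<b)) (trans (dft-cong u≗v k) (dft-idft v k<b))

    conv-cong : ∀ {G G′ H H′} → G ≗F G′ → H ≗F H′ → conv G H ≗F conv G′ H′
    conv-cong G≗G′ H≗H′ t = sum-cong 0 b λ m → *-cong (G≗G′ _) (H≗H′ _)

    conv-dft : ∀ {G H} → Periodic G → Periodic H → conv G H ≗F idft (λ j → dft G j * dft H j)
    conv-dft {G} {H} G-per H-per t =
      trans (conv-cong (λ s → sym (idft-dft G G-per s)) (λ s → sym (idft-dft H H-per s)) t)
            (conv-idft (dft G) (dft H) t)

    conv-comm : ∀ {G H} → Periodic G → Periodic H → conv G H ≗F conv H G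
    conv-comm {G} {H} G-per H-per t = begin
      conv G H t                               ≈⟨ conv-dft G-per H-per t ⟩
      idft (λ j → dft G j * dft H j) t         ≈⟨ idft-cong (λ j _ → *-comm _ _) t ⟩
      idft (λ j → dft H j * dft G j) t         ≈⟨ conv-dft H-per G-per t ⟨
      conv H G t                               ∎

    δb-idft : δb ≗F idft (λ _ → 1#)
    δb-idft t = sym (begin
      β * sumFrom 0 b (λ j → 1# * χ j t)  ≈⟨ *-congˡ (sum-cong 0 b λ j → *-identityˡ _) ⟩
      β * sumFrom 0 b (λ j → χ j t)       ≈⟨ *-congˡ (character-sum t) ⟩
      β * (fromℕ b * δb t)                ≈⟨ β*[b*x]≈x _ ⟩
      δb t                                ∎)

    idft-translate : ∀ u a t → idft u (t ℤ.+ + a) ≈ idft (λ j → ξ ^ℕ (j ℕ.* a) * u j) t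
    idft-translate u a t = *-congˡ (sum-cong 0 b λ j → begin
      u j * χ j (t ℤ.+ + a)                  ≈⟨ *-congˡ (r+s≡t⇒ξʳξˢ≈ξᵗ (+ j ℤ.* t) (+ j ℤ.* + a)
                                                  (Eq.sym (ℤP.*-distribˡ-+ (+ j) t (+ a)))) ⟨
      u j * (χ j t * ξ ^ℤ (+ j ℤ.* + a))     ≡⟨ Eq.cong (λ r → u j * (χ j t * ξ ^ℤ r)) (ℤP.pos-* j a) ⟨
      u j * (χ j t * ξ ^ℕ (j ℕ.* a))         ≈⟨ x∙yz≈z∙xy _ _ _ ⟩
      ξ ^ℕ (j ℕ.* a) * (u j * χ j t)         ≈⟨ *-assoc _ _ _ ⟨
      (ξ ^ℕ (j ℕ.* a) * u j) * χ j t         ∎)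

    idft-- : ∀ u v t → idft u t - idft v t ≈ idft (λ j → u j - v j) t
    idft-- u v t = begin
      β * Σu - β * Σv                         ≈⟨ x[y-z]≈xy-xz β Σu Σv ⟨
      β * (Σu - Σv)                           ≈⟨ *-congˡ (sum-- 0 b _ _) ⟩
      β * sumFrom 0 b (λ j → u j * χ j t - v j * χ j t)
        ≈⟨ *-congˡ (sum-cong 0 b λ j → sym ([y-z]x≈yx-zx (χ j t) (u j) (v j))) ⟩
      idft (λ j → u j - v j) t                ∎
      where
      Σu = sumFrom 0 b (λ j → u j * χ j t)
      Σv = sumFrom 0 b (λ j → v j * χ j t)

    IminusT-idft : ∀ a {h u} → h ≗F idft u → IminusT a h ≗F idft (λ j → (1# - ξ ^ℕ (j ℕ.* a)) * u j)
    IminusT-idft a {h} {u} h≗u t = begin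
      h t - h (t ℤ.+ + a)                                ≈⟨ +-cong (h≗u t) (-‿cong (h≗u (t ℤ.+ + a))) ⟩
      idft u t - idft u (t ℤ.+ + a)                      ≈⟨ +-congˡ (-‿cong (idft-translate u a t)) ⟩
      idft u t - idft (λ j → ξ ^ℕ (j ℕ.* a) * u j) t     ≈⟨ idft-- u _ t ⟩
      idft (λ j → u j - ξ ^ℕ (j ℕ.* a) * u j) t          ≈⟨ idft-cong (λ j _ → coefficient j) t ⟩
      idft (λ j → (1# - ξ ^ℕ (j ℕ.* a)) * u j) t         ∎
      where
      coefficient : ∀ j → u j - ξ ^ℕ (j ℕ.* a) * u j ≈ (1# - ξ ^ℕ (j ℕ.* a)) * u j
      coefficient j = trans (+-congʳ (sym (*-identityˡ (u j)))) (sym ([y-z]x≈yx-zx (u j) 1# _))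

    invFormula-idft : ∀ as → invFormula as ≗F idft (prodDen as)
    invFormula-idft []       = δb-idft
    invFormula-idft (a ∷ as) = IminusT-idft a (invFormula-idft as)

    -- Fourier–Dedekind sums

    1-ξ^ja≉0 : ∀ {a j} → Coprime a b → 0 < j → j < b → ¬ 1# - ξ ^ℕ (j ℕ.* a) ≈ 0#
    1-ξ^ja≉0 {a} {suc j} a⊥b _ j<b 1-ξ^ja≈0 = >⇒∤ j<b (coprime-divisor (Coprime.sym a⊥b)
      (Eq.subst (b ∣_) (ℕP.*-comm (suc j) a) (ξ^≈1⇒∣ (sym (x∙y⁻¹≈ε⇒x≈y _ _ 1-ξ^ja≈0)))))

    prodDen≉0 : ∀ {as} → All (λ a → Coprime a b) as → ∀ {j} → 0 < j → j < b → ¬ prodDen as j ≈ 0#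
    prodDen≉0 []           0<j j<b = 1≉0
    prodDen≉0 (a⊥b ∷ as⊥b) 0<j j<b = x*y≉0 (1-ξ^ja≉0 a⊥b 0<j j<b) (prodDen≉0 as⊥b 0<j j<b)

    prodDen-zero : ∀ {as} → as ≢ [] → prodDen as 0 ≈ 0#
    prodDen-zero {[]}     as≢[] = contradiction Eq.refl as≢[]
    prodDen-zero {a ∷ as} _     = trans (*-congʳ (-‿inverseʳ 1#)) (zeroˡ _)

    dedekindCoeff : List ℕ → ℕ → Carrier
    dedekindCoeff as zero    = 0#
    dedekindCoeff as (suc j) = prodDen as (suc j) ⁻¹

    inverseCoeff : List ℕ → ℕ → Carrier
    inverseCoeff as zero    = 0#
    inverseCoeff as (suc j) = prodDen as (suc j)

    S≗idft : ∀ as → S as ≗F idft (dedekindCoeff as)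
    S≗idft as t = *-congˡ (sym (begin
      sumFrom 0 b (λ j → d j * χ j t)                         ≡⟨ sum-split b _ ⟩
      d 0 * χ 0 t + sumFrom 1 (b ℕ.∸ 1) (λ j → d j * χ j t)   ≈⟨ +-congʳ (zeroˡ _) ⟩
      0# + sumFrom 1 (b ℕ.∸ 1) (λ j → d j * χ j t)            ≈⟨ +-identityˡ _ ⟩
      sumFrom 1 (b ℕ.∸ 1) (λ j → d j * χ j t)                 ≡⟨ sum-shift 0 (b ℕ.∸ 1) _ ⟩
      sumFrom 0 (b ℕ.∸ 1) (λ j → d (suc j) * χ (suc j) t)     ≈⟨ sum-cong 0 (b ℕ.∸ 1) (λ j → *-comm _ _) ⟩
      sumFrom 0 (b ℕ.∸ 1) (λ j → χ (suc j) t * d (suc j))     ≡⟨ sum-shift 0 (b ℕ.∸ 1) _ ⟨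
      sumFrom 1 (b ℕ.∸ 1) (λ j → χ j t * prodDen as j ⁻¹)     ∎))
      where d = dedekindCoeff as

    S∈V0 : ∀ as → InV0 (S as)
    S∈V0 as = InV0-resp-≗F (S≗idft as) (idft∈V0 _ refl)

    conv-S : ∀ as {g} → Periodic g → conv (S as) g ≗F idft (λ j → dedekindCoeff as j * dft g j)
    conv-S as {g} g-per t = trans (conv-cong (S≗idft as) (λ s → sym (idft-dft g g-per s)) t)
                                  (conv-idft _ _ t)

    Sb-unitˡ : ∀ {f} → InV0 f → conv Sb f ≗F f
    Sb-unitˡ {f} (f-per , Σf≈0) t = begin
      conv Sb f t                              ≈⟨ conv-S [] f-per t ⟩
      idft (λ j → dedekindCoeff [] j * dft f j) t  ≈⟨ idft-cong unit t ⟩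
      idft (dft f) t                           ≈⟨ idft-dft f f-per t ⟩
      f t                                      ∎
      where
      unit : ∀ j → j < b → dedekindCoeff [] j * dft f j ≈ dft f j
      unit zero    _ = trans (zeroˡ _) (sym (trans (dft-zero f) Σf≈0))
      unit (suc j) _ = trans (*-congʳ 1⁻¹≈1) (*-identityˡ _)

    Sb-unitʳ : ∀ {f} → InV0 f → conv f Sb ≗F f
    Sb-unitʳ f∈V0 t = trans (conv-comm (proj₁ f∈V0) (proj₁ (S∈V0 [])) t) (Sb-unitˡ f∈V0 t)

    inverse∈V0 : ∀ as → InV0 (idft (inverseCoeff as))
    inverse∈V0 as = idft∈V0 _ refl

    inverseˡ : ∀ {as} → All (λ a → Coprime a b) as → conv (S as) (idft (inverseCoeff as)) ≗F Sb
    inverseˡ {as} as⊥b t = begin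
      conv (S as) (idft (inverseCoeff as)) t                        ≈⟨ conv-S as (idft-periodic _) t ⟩
      idft (λ j → dedekindCoeff as j * dft (idft (inverseCoeff as)) j) t ≈⟨ idft-cong coefficient t ⟩
      idft (dedekindCoeff []) t                                     ≈⟨ S≗idft [] t ⟨
      Sb t                                                          ∎
      where
      coefficient : ∀ j → j < b → dedekindCoeff as j * dft (idft (inverseCoeff as)) j ≈ dedekindCoeff [] j
      coefficient zero    _   = zeroˡ _
      coefficient (suc j) j<b = begin
        P ⁻¹ * dft (idft (inverseCoeff as)) (suc j)   ≈⟨ *-congˡ (dft-idft _ j<b) ⟩
        P ⁻¹ * P                                      ≈⟨ *-comm _ _ ⟩
        P * P ⁻¹                                      ≈⟨ ⁻¹-inverse P (prodDen≉0 as⊥b (s≤s z≤n) j<b) ⟩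
        1#                                            ≈⟨ 1⁻¹≈1 ⟨
        1# ⁻¹                                         ∎
        where P = prodDen as (suc j)

    inverseʳ : ∀ {as} → All (λ a → Coprime a b) as → conv (idft (inverseCoeff as)) (S as) ≗F Sb
    inverseʳ {as} as⊥b t = trans (conv-comm (idft-periodic _) (proj₁ (S∈V0 as)) t) (inverseˡ as⊥b t)

    inverse-unique : ∀ {as} → All (λ a → Coprime a b) as → ∀ {g} → InV0 g →
      conv (S as) g ≗F Sb → g ≗F idft (inverseCoeff as)
    inverse-unique {as} as⊥b {g} (g-per , Σg≈0) Sg≗Sb t = begin
      g t              ≈⟨ idft-dft g g-per t ⟨
      idft (dft g) t   ≈⟨ idft-cong coefficient t ⟩
      idft (inverseCoeff as) t ∎
      where
      products : ∀ k → k < b → dedekindCoeff as k * dft g k ≈ dedekindCoeff [] k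
      products = idft-injective λ s →
        trans (sym (conv-S as g-per s)) (trans (Sg≗Sb s) (S≗idft [] s))
      coefficient : ∀ k → k < b → dft g k ≈ inverseCoeff as k
      coefficient zero    _   = trans (dft-zero g) Σg≈0
      coefficient (suc k) k<b =
        x⁻¹*y≈1⇒y≈x (prodDen≉0 as⊥b (s≤s z≤n) k<b) (trans (products (suc k) k<b) 1⁻¹≈1)

    inverse-formula : ∀ {as} → as ≢ [] → idft (inverseCoeff as) ≗F invFormula as
    inverse-formula {as} as≢[] t = trans (idft-cong coefficient t) (sym (invFormula-idft as t))
      where
      coefficient : ∀ j → j < b → inverseCoeff as j ≈ prodDen as j
      coefficient zero    _ = sym (prodDen-zero as≢[])
      coefficient (suc j) _ = refl

lemma5 : ∀ {c ℓ : Level} (F : Field c ℓ) (b : ℕ) (ξ : Field.Carrier F) →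
    2 ≤ b → Fourier.IsPrimitiveRoot F b ξ →
    let open Fourier F b ξ in
    (InV0 Sb × (∀ f → InV0 f → (conv Sb f ≗F f) × (conv f Sb ≗F f)))
    ×
    (∀ (as : List ℕ) → All (λ a → 1 ≤ a) as → All (λ a → Coprime a b) as →
      InV0 (S as) ×
      Σ Fun (λ g → InV0 g × (conv (S as) g ≗F Sb) × (conv g (S as) ≗F Sb)
        × (∀ g′ → InV0 g′ → conv (S as) g′ ≗F Sb → g′ ≗F g)
        × (¬ (as ≡ []) → g ≗F invFormula as)))
lemma5 F b ξ 2≤b prim =
    (S∈V0 [] , λ f f∈V0 → Sb-unitˡ f∈V0 , Sb-unitʳ f∈V0)
  , λ as _ as⊥b → S∈V0 as
      , idft (inverseCoeff as) , inverse∈V0 as , inverseˡ as⊥b , inverseʳ as⊥b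
      , (λ g′ g′∈V0 → inverse-unique as⊥b g′∈V0) , inverse-formula
  where
  instance
    b≢0 : ℕ.NonZero b
    b≢0 = ℕ.>-nonZero (ℕP.<⇒≤ 2≤b)
  open DiscreteFourier F b ξ
  open Primitive prim
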